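{- Let $N$ and $M$ be temporal networks whose underlying graphs are both isomorphic to a diaster $D(a,b)$, and suppose $N$ and $M$ are temporally isomorphic. Then there is a finite sequence of transpositions of temporal labels $p_1,\ldots,p_n$, where each $p_i$, at the moment it is applied, swaps two consecutive labels $s$ and $s+1$ lying on two non-adjacent edges, such that the labeling $\pi(N)$ obtained from $N$ by successively applying them ($\pi=p_1p_2\cdots p_n$) is label isomorphic to $M$.
   Context: A temporal network $N=(V,E,\tau)$ is a finite graph $(V,E)$ together with a bijection $\tau:E\to\{1,2,\ldots,|E|\}$. Two edges are adjacent if they share a vertex. A temporal path is a sequence of edges $\langle\{v_1,v_2\},\{v_2,v_3\},\ldots,\{v_k,v_{k+1}\}\rangle$ whose labels are strictly increasing along the sequence. $N=(V,E,\tau)$ and $M=(V',E',\tau')$ are temporally isomorphic if there is a graph isomorphism $\phi:V\to V'$ mapping every temporal path $\langle\{v_1,v_2\},\ldots,\{v_k,v_{k+1}\}\rangle$ of $N$ to a temporal path $\langle\{\phi(v_1),\phi(v_2)\},\ldots,\{\phi(v_k),\phi(v_{k+1})\}\rangle$ of $M$; they are label isomorphic if there is a graph isomorphism $\phi$ with $\tau(\{v_i,v_j\})=\tau'(\{\phi(v_i),\phi(v_j)\})$ for every edge. The diaster $D(a,b)$ ($a,b$ nonnegative integers) is the tree consisting of two adjacent vertices $u,w$ (central edge $\{u,w\}$) together with $a$ vertices of degree $1$ adjacent to $u$ and $b$ vertices of degree $1$ adjacent to $w$. -}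

module Defs where

open import Data.Nat using (ℕ; zero; suc; _+_; _≤_; _<_)
open import Data.Fin using (Fin; toℕ; fromℕ<)
import Data.Fin as F
open import Data.Product using (Σ; ∃; _×_; _,_; proj₁; proj₂)
open import Data.Sum using (_⊎_)
open import Data.List using (List; []; _∷_; map)
open import Data.List.Relation.Unary.Linked using (Linked)
open import Relation.Binary.PropositionalEquality using (_≡_; _≢_)
open import Relation.Nullary using (¬_)
open import Function.Bundles using (Bijection; _⤖_; _⇔_)
open import Relation.Binary.Construct.Closure.ReflexiveTransitive using (Star)

record Graph : Set₁ where
  field
    size : ℕ
    Adj  : Fin size → Fin size → Set

open Graph public

record GraphIso (G H : Graph) : Set where
  field
    φ    : Fin (size G) ⤖ Fin (size H)
    pres : ∀ u v → Adj G u v ⇔ Adj H (Bijection.to φ u) (Bijection.to φ v)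

open GraphIso public

-- The diaster D(a,b): vertex 0 = u, vertex 1 = w,
-- vertices 2 .. a+1 are the a leaves at u,
-- vertices a+2 .. a+b+1 are the b leaves at w.

data DArc (a b : ℕ) : Fin (2 + a + b) → Fin (2 + a + b) → Set where
  central : ∀ {x y} → toℕ x ≡ 0 → toℕ y ≡ 1 → DArc a b x y
  leafU   : ∀ {x y} → toℕ x ≡ 0 → 2 ≤ toℕ y → toℕ y < 2 + a → DArc a b x y
  leafW   : ∀ {x y} → toℕ x ≡ 1 → 2 + a ≤ toℕ y → DArc a b x y

D : ℕ → ℕ → Graph
D a b = record
  { size = 2 + a + b
  ; Adj  = λ x y → DArc a b x y ⊎ DArc a b y x
  }

-- A network with n vertices and m edges is given by the list of its
-- edges ordered by label: ends l is the edge with label l (Fin m codes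
-- the labels 1..m, label l ↦ toℕ l + 1).  The labelling τ is then the
-- inverse of ends; well-formedness says that there are no loops and
-- that distinct labels give distinct (unordered) edges.

Lab : ℕ → ℕ → Set
Lab n m = Fin m → Fin n × Fin n

Edge : ∀ {n m} → Lab n m → Fin m → Fin n → Fin n → Set
Edge L l u v = (L l ≡ (u , v)) ⊎ (L l ≡ (v , u))

record TemporalNetwork : Set where
  field
    n        : ℕ
    m        : ℕ
    ends     : Lab n m
    loopless : ∀ l → proj₁ (ends l) ≢ proj₂ (ends l)
    simple   : ∀ l l' → Edge ends l' (proj₁ (ends l)) (proj₂ (ends l)) → l ≡ l'

open TemporalNetwork public

UG : ∀ {n m} → Lab n m → Graph
UG {n} L = record { size = n ; Adj = λ u v → ∃ λ l → Edge L l u v }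

data Walk {n m} (L : Lab n m) : List (Fin n) → List (Fin m) → Set where
  stop : ∀ v → Walk L (v ∷ []) []
  step : ∀ {u v vs ls} l → Edge L l u v → Walk L (v ∷ vs) ls →
         Walk L (u ∷ v ∷ vs) (l ∷ ls)

TemporalPath : ∀ {n m} → Lab n m → List (Fin n) → Set
TemporalPath {n} {m} L vs =
  Σ (List (Fin m)) λ ls → Walk L vs ls × Linked F._<_ ls

TemporallyIsomorphic : ∀ {n m n' m'} → Lab n m → Lab n' m' → Set
TemporallyIsomorphic L L' =
  Σ (GraphIso (UG L) (UG L')) λ ι →
    ∀ vs → TemporalPath L vs → TemporalPath L' (map (Bijection.to (φ ι)) vs)

LabelIsomorphic : ∀ {n m n' m'} → Lab n m → Lab n' m' → Set
LabelIsomorphic {n} {m} {n'} {m'} L L' =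
  Σ (GraphIso (UG L) (UG L')) λ ι →
    ∀ (l : Fin m) u v → Edge L l u v →
      Σ (Fin m') λ l' → (toℕ l ≡ toℕ l') ×
        Edge L' l' (Bijection.to (φ ι) u) (Bijection.to (φ ι) v)

swapLab : ∀ {m} (s t : Fin m) → Fin m → Fin m
swapLab s t l with l F.≟ s | l F.≟ t
... | Relation.Nullary.yes _ | _ = t
... | Relation.Nullary.no _ | Relation.Nullary.yes _ = s
... | Relation.Nullary.no _ | Relation.Nullary.no _ = l

NonAdjacent : ∀ {n} → Fin n × Fin n → Fin n × Fin n → Set
NonAdjacent (x , y) (z , w) = x ≢ z × x ≢ w × y ≢ z × y ≢ w

data Swap {n m} : Lab n m → Lab n m → Set where
  swap : ∀ {L L'} (s t : Fin m) → toℕ t ≡ suc (toℕ s) →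
         NonAdjacent (L s) (L t) →
         (∀ l → L' l ≡ L (swapLab s t l)) →
         Swap L L'

-- A temporal isomorphism φ preserves the order of the labels of any two
-- adjacent edges, since the two edges form a temporal path.  Hence if the
-- edges of N are listed in the order of their labels in M, every pair whose
-- order changes is a pair of non-adjacent edges.  Insertion sort reaches that
-- order by transpositions of neighbours which only ever swap such a pair, and
-- each of them swaps labels s and s + 1 of the current labelling.  The
-- target order uses every label of M exactly once, because φ induces
-- injections between the two edge sets in both directions.  The argument
-- works for arbitrary simple graphs.

module Submission where

open import Defs
open import Data.Nat using (ℕ; zero; suc; _+_; _≤_; _<_; z≤n; s≤s)
import Data.Nat.Properties as ℕₚ
open import Data.Fin using (Fin; toℕ; fromℕ<; zero; suc)
import Data.Fin as Fin
import Data.Fin.Properties as Finₚ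
open import Data.Vec using (Vec; []; _∷_; lookup; tabulate)
open import Data.Vec.Properties using (lookup∘tabulate)
open import Data.Vec.Relation.Unary.All as All using (All; []; _∷_)
open import Data.Vec.Relation.Unary.All.Properties using (tabulate⁺)
open import Data.Vec.Relation.Unary.AllPairs using (AllPairs; []; _∷_)
open import Data.Product using (Σ; ∃; _×_; _,_; proj₁; proj₂)
import Data.Product as Product
open import Data.Sum using (_⊎_; inj₁; inj₂)
import Data.List as List
open import Data.List.Relation.Unary.Linked using ([-]; _∷_)
open import Data.Empty using (⊥)
open import Function using (_∘_; id)
open import Function.Bundles using (Bijection; Equivalence; mk⇔)
open import Function.Definitions using (Injective)
open import Relation.Nullary using (Dec; yes; no)
open import Relation.Nullary.Negation using (contradiction)
open import Relation.Binary.PropositionalEquality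
open import Relation.Binary.Construct.Closure.ReflexiveTransitive
  using (Star; ε; _◅_; _◅◅_; gmap)
open import Relation.Binary.Definitions using (tri<; tri≈; tri>)

-- Edge L l u v unfolds to L l ≍ (u , v).
infix 4 _≍_

_≍_ : {A : Set} → A × A → A × A → Set
e ≍ e′ = e ≡ e′ ⊎ e ≡ Product.swap e′

≍-sym : {A : Set} {e e′ : A × A} → e ≍ e′ → e′ ≍ e
≍-sym (inj₁ refl) = inj₁ refl
≍-sym (inj₂ refl) = inj₂ refl

≍-trans : {A : Set} {e e′ e″ : A × A} → e ≍ e′ → e′ ≍ e″ → e ≍ e″
≍-trans (inj₁ refl) q           = q
≍-trans (inj₂ refl) (inj₁ refl) = inj₂ refl
≍-trans (inj₂ refl) (inj₂ refl) = inj₁ refl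

≍-map : {A B : Set} (f : A → B) {e e′ : A × A} →
        e ≍ e′ → Product.map f f e ≍ Product.map f f e′
≍-map f (inj₁ p) = inj₁ (cong (Product.map f f) p)
≍-map f (inj₂ p) = inj₂ (cong (Product.map f f) p)

≍-map⁻ : {A B : Set} {f : A → B} → Injective _≡_ _≡_ f → {e e′ : A × A} →
         Product.map f f e ≍ Product.map f f e′ → e ≍ e′
≍-map⁻ f-inj (inj₁ p) = inj₁ (cong₂ _,_ (f-inj (cong proj₁ p)) (f-inj (cong proj₂ p)))
≍-map⁻ f-inj (inj₂ p) = inj₂ (cong₂ _,_ (f-inj (cong proj₁ p)) (f-inj (cong proj₂ p)))

label-unique : (T : TemporalNetwork) {l l′ : Fin (m T)} {u v : Fin (n T)} →
               Edge (ends T) l u v → Edge (ends T) l′ u v → l ≡ l′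
label-unique T {l} {l′} e e′ = simple T l l′ (≍-trans e′ (≍-sym e))

module EdgeMap (T T′ : TemporalNetwork) (h : Fin (n T) → Fin (n T′))
  (h-adj : ∀ {u v} → Adj (UG (ends T)) u v → Adj (UG (ends T′)) (h u) (h v)) where

  edgeMap : Fin (m T) → Fin (m T′)
  edgeMap l = proj₁ (h-adj (l , inj₁ refl))

  edgeMap-ends : ∀ l → ends T′ (edgeMap l) ≍ Product.map h h (ends T l)
  edgeMap-ends l = proj₂ (h-adj (l , inj₁ refl))

  edgeMap-edge : ∀ {l u v} → Edge (ends T) l u v → Edge (ends T′) (edgeMap l) (h u) (h v)
  edgeMap-edge {l} e = ≍-trans (edgeMap-ends l) (≍-map h e)

  edgeMap-injective : Injective _≡_ _≡_ h → Injective _≡_ _≡_ edgeMap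
  edgeMap-injective h-inj {i} {j} eq =
    simple T i j (≍-sym (≍-map⁻ h-inj (≍-trans (≍-sym i-ends) (edgeMap-ends j))))
    where
      i-ends : ends T′ (edgeMap j) ≍ Product.map h h (ends T i)
      i-ends = subst (λ l → ends T′ l ≍ Product.map h h (ends T i)) eq (edgeMap-ends i)

  m≤m′ : Injective _≡_ _≡_ h → m T ≤ m T′
  m≤m′ h-inj = Finₚ.injective⇒≤ (edgeMap-injective h-inj)

swapLab-source : ∀ {k} (s t : Fin k) → swapLab s t s ≡ t
swapLab-source s t with s Fin.≟ s
... | yes _  = refl
... | no s≢s = contradiction refl s≢s

swapLab-target : ∀ {k} (s t : Fin k) → s ≢ t → swapLab s t t ≡ s
swapLab-target s t s≢t with t Fin.≟ s | t Fin.≟ t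
... | yes t≡s | _      = contradiction (sym t≡s) s≢t
... | no _    | yes _  = refl
... | no _    | no t≢t = contradiction refl t≢t

swapLab-other : ∀ {k} (s t l : Fin k) → l ≢ s → l ≢ t → swapLab s t l ≡ l
swapLab-other s t l l≢s l≢t with l Fin.≟ s | l Fin.≟ t
... | yes l≡s | _       = contradiction l≡s l≢s
... | no _    | yes l≡t = contradiction l≡t l≢t
... | no _    | no _    = refl

swapLab-suc : ∀ {k} {s t : Fin k} → s ≢ t →
              ∀ l → swapLab (suc s) (suc t) (suc l) ≡ suc (swapLab s t l)
swapLab-suc {s = s} {t} s≢t l = by-cases (l Fin.≟ s) (l Fin.≟ t)
  where
    by-cases : Dec (l ≡ s) → Dec (l ≡ t) → swapLab (suc s) (suc t) (suc l) ≡ suc (swapLab s t l)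
    by-cases (yes refl) _ =
      trans (swapLab-source (suc s) (suc t)) (cong suc (sym (swapLab-source s t)))
    by-cases (no _) (yes refl) =
      trans (swapLab-target (suc s) (suc t) (s≢t ∘ Finₚ.suc-injective))
            (cong suc (sym (swapLab-target s t s≢t)))
    by-cases (no l≢s) (no l≢t) =
      trans (swapLab-other (suc s) (suc t) (suc l)
                           (l≢s ∘ Finₚ.suc-injective) (l≢t ∘ Finₚ.suc-injective))
            (cong suc (sym (swapLab-other s t l l≢s l≢t)))

module AdjacentSwaps {A : Set} (Swappable : A → A → Set) where

  data Step : ∀ {j} → Vec A j → Vec A j → Set where
    here  : ∀ {j x y} {xs : Vec A j} → Swappable x y → Step (x ∷ y ∷ xs) (y ∷ x ∷ xs)
    there : ∀ {j x} {xs ys : Vec A j} → Step xs ys → Step (x ∷ xs) (x ∷ ys)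

  Steps : ∀ {j} → Vec A j → Vec A j → Set
  Steps = Star Step

  there⋆ : ∀ {j x} {xs ys : Vec A j} → Steps xs ys → Steps (x ∷ xs) (x ∷ ys)
  there⋆ = gmap (_ ∷_) there

  step-All : ∀ {P : A → Set} {j} {xs ys : Vec A j} → Step xs ys → All P xs → All P ys
  step-All (here _)  (p ∷ q ∷ ps) = q ∷ p ∷ ps
  step-All (there s) (p ∷ ps)     = p ∷ step-All s ps

  steps-All : ∀ {P : A → Set} {j} {xs ys : Vec A j} → Steps xs ys → All P xs → All P ys
  steps-All ε        ps = ps
  steps-All (s ◅ ss) ps = steps-All ss (step-All s ps)

module SortByKey {A : Set} (key : A → ℕ) (Swappable : A → A → Set) where

  open AdjacentSwaps Swappable

  Sorted : ∀ {j} → Vec A j → Set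
  Sorted = AllPairs (λ x y → key x < key y)

  -- x may stay in front of y, or be moved past it
  Admissible : A → A → Set
  Admissible x y = key x < key y ⊎ (key y < key x × Swappable x y)

  insert : ∀ {j} x {ys : Vec A j} → Sorted ys → All (Admissible x) ys →
           ∃ λ zs → Steps (x ∷ ys) zs × Sorted zs
  insert x {[]} [] [] = _ , ε , [] ∷ []
  insert x {y ∷ ys} (y<ys ∷ ys↑) (inj₁ x<y ∷ _) =
    _ , ε , (x<y ∷ All.map (ℕₚ.<-trans x<y) y<ys) ∷ y<ys ∷ ys↑
  insert x {y ∷ ys} (y<ys ∷ ys↑) (inj₂ (y<x , sw) ∷ x-ys) with insert x ys↑ x-ys
  ... | zs , ys⇝zs , zs↑ = y ∷ zs , here sw ◅ there⋆ ys⇝zs , steps-All ys⇝zs (y<x ∷ y<ys) ∷ zs↑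

  sort : ∀ {j} {xs : Vec A j} → AllPairs Admissible xs → ∃ λ ys → Steps xs ys × Sorted ys
  sort [] = [] , ε , []
  sort (x-xs ∷ xs↕) with sort xs↕
  ... | ys , xs⇝ys , ys↑ with insert _ ys↑ (steps-All xs⇝ys x-xs)
  ...   | zs , ys⇝zs , zs↑ = zs , there⋆ xs⇝ys ◅◅ ys⇝zs , zs↑

  sorted-head-bound : ∀ {j b x} {xs : Vec A j} → Sorted (x ∷ xs) →
                      All (λ y → key y < b) (x ∷ xs) → key x + j < b
  sorted-head-bound {x = x} {[]} _ (x<b ∷ []) = subst (_< _) (sym (ℕₚ.+-identityʳ (key x))) x<b
  sorted-head-bound {suc j} {x = x} {y ∷ ys} ((x<y ∷ _) ∷ ys↑) (_ ∷ ys<b) = begin-strict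
    key x + suc j   ≡⟨ ℕₚ.+-suc (key x) j ⟩
    suc (key x) + j ≤⟨ ℕₚ.+-monoˡ-≤ j x<y ⟩
    key y + j       <⟨ sorted-head-bound ys↑ ys<b ⟩
    _               ∎
    where open ℕₚ.≤-Reasoning

  sorted-keys : ∀ {j} a {xs : Vec A j} → Sorted xs → All (λ y → a ≤ key y) xs →
                All (λ y → key y < a + j) xs → ∀ i → key (lookup xs i) ≡ a + toℕ i
  sorted-keys {suc j} a {x ∷ xs} (x<xs ∷ xs↑) (a≤x ∷ _) xs<b = keys
    where
      x≡a : key x ≡ a
      x≡a = ℕₚ.≤-antisym
        (ℕₚ.+-cancelʳ-≤ j (key x) a (ℕₚ.<⇒≤pred
          (subst (key x + j <_) (ℕₚ.+-suc a j) (sorted-head-bound (x<xs ∷ xs↑) xs<b))))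
        a≤x
      keys : ∀ i → key (lookup (x ∷ xs) i) ≡ a + toℕ i
      keys zero    = trans x≡a (sym (ℕₚ.+-identityʳ a))
      keys (suc i) = trans
        (sorted-keys (suc a) xs↑ (All.map (subst (_< _) x≡a) x<xs)
                     (All.map (λ {y} → subst (key y <_) (ℕₚ.+-suc a j)) (All.tail xs<b)) i)
        (sym (ℕₚ.+-suc a (toℕ i)))

allPairs-tabulate⁺ : {A : Set} {R : A → A → Set} {j : ℕ} {f : Fin j → A} →
                     (∀ {i i′} → i Fin.< i′ → R (f i) (f i′)) → AllPairs R (tabulate f)
allPairs-tabulate⁺ {j = zero}  _  = []
allPairs-tabulate⁺ {j = suc j} R< = tabulate⁺ (λ _ → R< (s≤s z≤n)) ∷ allPairs-tabulate⁺ (R< ∘ s≤s)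

module Relabelling {n k : ℕ} (E : Lab n k) where

  open AdjacentSwaps (λ x y → NonAdjacent (E x) (E y))

  step⇒transposition : ∀ {j} {xs ys : Vec (Fin k) j} → Step xs ys →
    Σ (Fin j) λ s → Σ (Fin j) λ t → toℕ t ≡ suc (toℕ s) ×
      NonAdjacent (E (lookup xs s)) (E (lookup xs t)) ×
      (∀ l → lookup ys l ≡ lookup xs (swapLab s t l))
  step⇒transposition (here {x = x} {y} {xs} sw) = zero , suc zero , refl , sw , swapped
    where
      swapped : ∀ l → lookup (y ∷ x ∷ xs) l ≡ lookup (x ∷ y ∷ xs) (swapLab zero (suc zero) l)
      swapped zero          = cong (lookup (x ∷ y ∷ xs)) (sym (swapLab-source zero (suc zero)))
      swapped (suc zero)    = cong (lookup (x ∷ y ∷ xs)) (sym (swapLab-target zero (suc zero) λ ()))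
      swapped (suc (suc l)) =
        cong (lookup (x ∷ y ∷ xs)) (sym (swapLab-other zero (suc zero) (suc (suc l)) (λ ()) (λ ())))
  step⇒transposition (there {x = x} {xs} {ys} st) with step⇒transposition st
  ... | s , t , t≡1+s , na , swapped = suc s , suc t , cong suc t≡1+s , na , swapped′
    where
      s≢t : s ≢ t
      s≢t s≡t = ℕₚ.1+n≢n (trans (sym t≡1+s) (cong toℕ (sym s≡t)))
      swapped′ : ∀ l → lookup (x ∷ ys) l ≡ lookup (x ∷ xs) (swapLab (suc s) (suc t) l)
      swapped′ zero    = cong (lookup (x ∷ xs)) (sym (swapLab-other (suc s) (suc t) zero (λ ()) (λ ())))
      swapped′ (suc l) = trans (swapped l) (cong (lookup (x ∷ xs)) (sym (swapLab-suc s≢t l)))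

  steps⇒swaps : ∀ {j} {xs ys : Vec (Fin k) j} → Steps xs ys → (L : Lab n j) →
                (∀ l → L l ≡ E (lookup xs l)) →
                Σ (Lab n j) λ L′ → Star Swap L L′ × (∀ l → L′ l ≡ E (lookup ys l))
  steps⇒swaps ε L L≗xs = L , ε , L≗xs
  steps⇒swaps (_◅_ {j = ys} st sts) L L≗xs with step⇒transposition st
  ... | s , t , t≡1+s , na , swapped with steps⇒swaps sts (E ∘ lookup ys) (λ _ → refl)
  ...   | L′ , swaps , L′≗ = L′ , first ◅ swaps , L′≗
    where
      first : Swap L (E ∘ lookup ys)
      first = swap s t t≡1+s (subst₂ NonAdjacent (sym (L≗xs s)) (sym (L≗xs t)) na)
                (λ l → trans (cong E (swapped l)) (sym (L≗xs _)))

module TemporalIsomorphism (N M : TemporalNetwork) (ι : GraphIso (UG (ends N)) (UG (ends M)))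
  (temporal : ∀ vs → TemporalPath (ends N) vs →
                     TemporalPath (ends M) (List.map (Bijection.to (φ ι)) vs))
  where

  open Bijection (φ ι) using (to⁻; strictlySurjective) renaming (to to f; injective to f-injective)

  open EdgeMap N M f (Equivalence.to (pres ι _ _))
    using (edgeMap-injective)
    renaming (edgeMap to relabel; edgeMap-ends to relabel-ends; edgeMap-edge to relabel-edge)

  relabel-injective : Injective _≡_ _≡_ relabel
  relabel-injective = edgeMap-injective f-injective

  m[M]≤m[N] : m M ≤ m N
  m[M]≤m[N] = EdgeMap.m≤m′ M N to⁻ to⁻-adj to⁻-injective
    where
      f∘to⁻ : ∀ u → f (to⁻ u) ≡ u
      f∘to⁻ = proj₂ ∘ strictlySurjective
      to⁻-injective : Injective _≡_ _≡_ to⁻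
      to⁻-injective {u} {v} eq = trans (sym (f∘to⁻ u)) (trans (cong f eq) (f∘to⁻ v))
      to⁻-adj : ∀ {u v} → Adj (UG (ends M)) u v → Adj (UG (ends N)) (to⁻ u) (to⁻ v)
      to⁻-adj {u} {v} = Equivalence.from (pres ι _ _)
                      ∘ subst₂ (Adj (UG (ends M))) (sym (f∘to⁻ u)) (sym (f∘to⁻ v))

  -- The two edges form a temporal path in N, hence their images one in M.
  relabel-<-adjacent : ∀ {i j p q r} → Edge (ends N) i p q → Edge (ends N) j q r →
                       i Fin.< j → relabel i Fin.< relabel j
  relabel-<-adjacent {i} {j} {p} {q} {r} e₁ e₂ i<j
    with temporal (p List.∷ q List.∷ r List.∷ List.[])
                  (i List.∷ j List.∷ List.[] , step i e₁ (step j e₂ (stop r)) , i<j ∷ [-])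
  ... | _ , step l₁ e₁′ (step l₂ e₂′ (stop _)) , l₁<l₂ ∷ [-] =
    subst₂ Fin._<_ (label-unique M e₁′ (relabel-edge e₁))
                   (label-unique M e₂′ (relabel-edge e₂)) l₁<l₂

  inversion⇒nonAdjacent : ∀ {i j} → i Fin.< j → relabel j Fin.< relabel i →
                          NonAdjacent (ends N i) (ends N j)
  inversion⇒nonAdjacent {i} {j} i<j j<i = x≢z , x≢w , y≢z , y≢w
    where
      x = proj₁ (ends N i)
      y = proj₂ (ends N i)
      z = proj₁ (ends N j)
      w = proj₂ (ends N j)
      unordered : ∀ {p q r} → Edge (ends N) i p q → Edge (ends N) j q r → ⊥
      unordered e₁ e₂ = Finₚ.<-asym (relabel-<-adjacent e₁ e₂ i<j) j<i
      x≢z : x ≢ z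
      x≢z x≡z = unordered (inj₂ refl) (inj₁ (cong (_, w) (sym x≡z)))
      x≢w : x ≢ w
      x≢w x≡w = unordered (inj₂ refl) (inj₂ (cong (z ,_) (sym x≡w)))
      y≢z : y ≢ z
      y≢z y≡z = unordered (inj₁ refl) (inj₁ (cong (_, w) (sym y≡z)))
      y≢w : y ≢ w
      y≢w y≡w = unordered (inj₁ refl) (inj₂ (cong (z ,_) (sym y≡w)))

  open AdjacentSwaps (λ x y → NonAdjacent (ends N x) (ends N y)) using (Steps; steps-All)
  open SortByKey (toℕ ∘ relabel) (λ x y → NonAdjacent (ends N x) (ends N y))

  sort-by-relabel : ∃ λ (ys : Vec (Fin (m N)) (m N)) →
                    Steps (tabulate id) ys × (∀ l → toℕ (relabel (lookup ys l)) ≡ toℕ l)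
  sort-by-relabel with sort (allPairs-tabulate⁺ admissible)
    where
      admissible : ∀ {i j} → i Fin.< j → Admissible i j
      admissible {i} {j} i<j with ℕₚ.<-cmp (toℕ (relabel i)) (toℕ (relabel j))
      ... | tri< i<j′ _ _ = inj₁ i<j′
      ... | tri≈ _ i≡j′ _ =
        contradiction (relabel-injective (Finₚ.toℕ-injective i≡j′)) (Finₚ.<⇒≢ i<j)
      ... | tri> _ _ j<i′ = inj₂ (j<i′ , inversion⇒nonAdjacent i<j j<i′)
  ... | ys , steps , ys↑ = ys , steps , sorted-keys 0 ys↑ (All.universal (λ _ → z≤n) ys) bounded
    where
      bounded : All (λ l → toℕ (relabel l) < m N) ys
      bounded = steps-All steps (tabulate⁺ (λ l → ℕₚ.<-≤-trans (Finₚ.toℕ<n (relabel l)) m[M]≤m[N]))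

  labelIsomorphic : (σ : Fin (m N) → Fin (m N)) → (∀ l → toℕ (relabel (σ l)) ≡ toℕ l) →
                    (L : Lab (n N) (m N)) → (∀ l → L l ≡ ends N (σ l)) → LabelIsomorphic L (ends M)
  labelIsomorphic σ σ-sorts L L≗ = iso , λ l _ _ e → relabel (σ l) , sym (σ-sorts l) , forward e
    where
      forward : ∀ {l u v} → Edge L l u v → Edge (ends M) (relabel (σ l)) (f u) (f v)
      forward {l} e = relabel-edge (≍-trans (inj₁ (sym (L≗ l))) e)
      backward : ∀ {u v} → Adj (UG (ends M)) (f u) (f v) → Adj (UG L) u v
      backward (l′ , e′) =
        l , ≍-trans (inj₁ (L≗ l)) (≍-map⁻ f-injective (≍-trans (≍-sym σl-ends) e′))
        where
          l = fromℕ< (ℕₚ.<-≤-trans (Finₚ.toℕ<n l′) m[M]≤m[N])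
          σl≡l′ : relabel (σ l) ≡ l′
          σl≡l′ = Finₚ.toℕ-injective (trans (σ-sorts l) (Finₚ.toℕ-fromℕ< _))
          σl-ends : ends M l′ ≍ Product.map f f (ends N (σ l))
          σl-ends = subst (λ k → ends M k ≍ Product.map f f (ends N (σ l))) σl≡l′ (relabel-ends (σ l))
      iso : GraphIso (UG L) (UG (ends M))
      iso = record { φ = φ ι ; pres = λ _ _ → mk⇔ (λ (l , e) → relabel (σ l) , forward e) backward }

proposition3 : (N M : TemporalNetwork) (a b : ℕ) →
    GraphIso (D a b) (UG (ends N)) →
    GraphIso (D a b) (UG (ends M)) →
    TemporallyIsomorphic (ends N) (ends M) →
    Σ (Lab (n N) (m N)) λ L →
    Star Swap (ends N) L × LabelIsomorphic L (ends M)
proposition3 N M _ _ _ _ (ι , temporal) =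
  let open TemporalIsomorphism N M ι temporal
      open Relabelling (ends N)
      ys , sorting , ys-sorted = sort-by-relabel
      L , swaps , L≗ys = steps⇒swaps sorting (ends N) (cong (ends N) ∘ sym ∘ lookup∘tabulate id)
  in L , swaps , labelIsomorphic (lookup ys) ys-sorted L L≗ys
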